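{- (1) Let $\phi$ be a finite or infinite closed proposition with truth values from $\{\mathbf{T},\mathbf{F},\bot_{\mathcal{HA}},\bot_{\mathcal{IL}},\bot_{\mathcal{O}}\}$. Then the normal form of $\phi$ in $\lambda_{\beta\bot_{\mathcal{HA}}\bot_{\mathcal{IL}}\bot_{\mathcal{O}}}$ is either $\mathbf{T}$, $\mathbf{F}$, $\bot_{\mathcal{HA}}$, $\bot_{\mathcal{IL}}$ or $\bot_{\mathcal{O}}$. (2) Let $\phi$ be a finite or infinite closed proposition with truth values from $\{\mathbf{T},\mathbf{F},\bot_{\mathcal{HA}},\bot_{\mathcal{IL}\cup\mathcal{O}}\}$. Then the normal form of $\phi$ in $\lambda_{\beta\bot_{\mathcal{HA}}\bot_{\mathcal{IL}\cup\mathcal{O}}}$ is either $\mathbf{T}$, $\mathbf{F}$, $\bot_{\mathcal{HA}}$ or $\bot_{\mathcal{IL}\cup\mathcal{O}}$.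
   Context: $\Lambda^\infty$: finite and infinite $\lambda$-terms (coinductive syntax), with possibly infinite strongly convergent $\beta$-reduction. A term is root-active if every reduct of it can be further reduced to a redex. $\mathcal{HA}$ = terms that finitely $\beta$-reduce to some $\lambda x_1\ldots x_n.RP_1\ldots P_k$ with $R$ root-active; $\mathcal{IL}$ = terms that (possibly infinitely) reduce to some $\lambda x_1\ldots x_n.((\ldots P_2)P_1)$ with infinite left spine; $\mathcal{O}$ = terms that (possibly infinitely) reduce to $\lambda x_1\lambda x_2\lambda x_3\ldots$. For a family of these sets, each with a new constant $\bot_{\mathcal{X}}$, the calculus $\lambda_{\beta\bot_{\mathcal{X}}\ldots}$ has terms over the coinductive syntax extended with the constants, and rules $\beta$ plus, for each $\mathcal{X}$, $C[M]\to C[\bot_{\mathcal{X}}]$ whenever $M$ (with constants replaced by terms from their sets) lies in $\mathcal{X}$; both calculi are confluent and normalising for strongly convergent reduction. Encoding: $\mathbf{T}\equiv\lambda xy.x$, $\mathbf{F}\equiv\lambda xy.y$, $\neg M\equiv M\,\mathbf{F}\,\mathbf{T}$, $M\land N\equiv M\,N\,M$, $M\lor N\equiv M\,M\,N$, $M\rightarrow N\equiv M\,N\,\mathbf{T}$. Propositions with truth values from a set $V$ are given by the coinductively read grammar $\phi::=p\mid v\mid(\phi\land\phi)\mid(\phi\lor\phi)\mid(\phi\rightarrow\phi)\mid\neg\phi$ with $v\in V$ and $p$ propositional variables; closed means no propositional variables. -}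

module Defs where

-- Infinite trees (λ-terms, propositions) are
-- therefore represented as functions from finite addresses to node
-- labels, and coinductive predicates/relations are rendered by
-- quantifying over all (finite) positions.

open import Data.Nat using (ℕ; zero; suc; _∸_; _+_; _<ᵇ_)
open import Data.Bool using (if_then_else_)
open import Data.Empty using (⊥)
open import Data.List using (List; []; _∷_; _++_; replicate)
open import Data.Product using (Σ; _×_; _,_)
open import Data.Sum using (_⊎_)
open import Relation.Binary.PropositionalEquality using (_≡_; _≢_)
open import Relation.Binary.Construct.Closure.ReflexiveTransitive using (Star)
open import Relation.Nullary using (¬_)

-- Finite and infinite λ-terms (Λ^∞, all positions may be infinite),
-- de Bruijn indices, over a set C of constants.
--
-- Directions:
-- dL / dR = function / argument of an application, dB = body of λ.
-- Labels at addresses that do not denote a position of the term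
-- (e.g. below a variable, or dB below an application) are junk and
-- are never inspected by the definitions below.

data Dir : Set where
  dL dR dB : Dir

Addr : Set
Addr = List Dir

data Lbl (C : Set) : Set where
  var : ℕ → Lbl C
  con : C → Lbl C
  lam : Lbl C
  app : Lbl C

Tm : Set → Set
Tm C = Addr → Lbl C

Λ∞ : Set
Λ∞ = Tm ⊥

_·_ : ∀ {C} → Tm C → Dir → Tm C
(t · d) q = t (d ∷ q)

_at_ : ∀ {C} → Tm C → Addr → Tm C
(t at p) q = t (p ++ q)

data Pos {C : Set} : Tm C → Addr → Set where
  here : ∀ {t} → Pos t []
  inL  : ∀ {t p} → t [] ≡ app → Pos (t · dL) p → Pos t (dL ∷ p)
  inR  : ∀ {t p} → t [] ≡ app → Pos (t · dR) p → Pos t (dR ∷ p)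
  inB  : ∀ {t p} → t [] ≡ lam → Pos (t · dB) p → Pos t (dB ∷ p)

-- ρ applied to the free variables of u (m = binders passed so far)
renAt : ∀ {C} → ℕ → (ℕ → ℕ) → Tm C → Addr → Lbl C
renAt m ρ u [] with u []
... | var j = if j <ᵇ m then var j else var (m + ρ (j ∸ m))
... | con c = con c
... | lam   = lam
... | app   = app
renAt m ρ u (d ∷ q) with u []
... | lam = renAt (suc m) ρ (u · d) q
... | _   = renAt m ρ (u · d) q

ren : ∀ {C} → (ℕ → ℕ) → Tm C → Tm C
ren ρ u = renAt 0 ρ u

shift : ∀ {C} → ℕ → Tm C → Tm C
shift k = ren (λ j → k + j)

-- simultaneous substitution σ for the free variables of t
-- (k = binders passed so far)
subAt : ∀ {C} → ℕ → (ℕ → Tm C) → Tm C → Addr → Lbl C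
subAt k σ t p with t []
subAt k σ t p       | var i = if i <ᵇ k then var i else shift k (σ (i ∸ k)) p
subAt k σ t []      | con c = con c
subAt k σ t []      | lam   = lam
subAt k σ t []      | app   = app
subAt k σ t (d ∷ q) | con c = con c
subAt k σ t (d ∷ q) | lam   = subAt (suc k) σ (t · d) q
subAt k σ t (d ∷ q) | app   = subAt k σ (t · d) q

sub : ∀ {C} → (ℕ → Tm C) → Tm C → Tm C
sub σ t = subAt 0 σ t

vr : ∀ {C} → ℕ → Tm C
vr i _ = var i

β-env : ∀ {C} → Tm C → ℕ → Tm C
β-env N zero = N
β-env N (suc i) = vr i

_[_] : ∀ {C} → Tm C → Tm C → Tm C
B [ N ] = sub (β-env N) B

module _ {C : Set} where

  data AppSpine (P : Tm C → Set) : Tm C → Set where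
    head : ∀ {M} → P M → AppSpine P M
    app  : ∀ {M} → M [] ≡ app → AppSpine P (M · dL) → AppSpine P M

  data LamPrefix (P : Tm C → Set) : Tm C → Set where
    body : ∀ {M} → P M → LamPrefix P M
    lam  : ∀ {M} → M [] ≡ lam → LamPrefix P (M · dB) → LamPrefix P M

  InfLeft : Tm C → Set
  InfLeft M = ∀ n → M (replicate n dL) ≡ app

  AllLam : Tm C → Set
  AllLam M = ∀ n → M (replicate n dB) ≡ lam

  Redex : Tm C → Set
  Redex M = (M [] ≡ app) × (M (dL ∷ []) ≡ lam)

  IsT : Tm C → Set
  IsT M = (M [] ≡ lam) × (M (dB ∷ []) ≡ lam) × (M (dB ∷ dB ∷ []) ≡ var 1)

  IsF : Tm C → Set
  IsF M = (M [] ≡ lam) × (M (dB ∷ []) ≡ lam) × (M (dB ∷ dB ∷ []) ≡ var 0)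

  IsConst : C → Tm C → Set
  IsConst c M = M [] ≡ con c

-- The calculus λ_{β⊥…}: constants C, each constant c standing for a set
-- X c of pure terms.

module Calculus {C : Set} (X : C → Λ∞ → Set) where

  ReplLbl : Lbl C → Λ∞ → Set
  ReplLbl (var i) T = T [] ≡ var i
  ReplLbl (con c) T = X c T
  ReplLbl lam     T = T [] ≡ lam
  ReplLbl app     T = T [] ≡ app

  Repl : Tm C → Λ∞ → Set
  Repl M M₀ = ∀ p → Pos M p → ReplLbl (M p) (M₀ at p)

  data Step : Tm C → Tm C → Set where
    β      : ∀ {M M'} → M [] ≡ app → M (dL ∷ []) ≡ lam →
             (∀ q → M' q ≡ (((M · dL) · dB) [ M · dR ]) q) → Step M M'
    ⊥-rule : ∀ {M M'} (c : C) → M [] ≢ con c →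
             (M₀ : Λ∞) → Repl M M₀ → X c M₀ →
             M' [] ≡ con c → Step M M'
    lam    : ∀ {M M' B'} → M [] ≡ lam → Step (M · dB) B' →
             M' [] ≡ lam → (∀ q → M' (dB ∷ q) ≡ B' q) → Step M M'
    appˡ   : ∀ {M M' F'} → M [] ≡ app → Step (M · dL) F' →
             M' [] ≡ app → (∀ q → M' (dL ∷ q) ≡ F' q) →
             (∀ q → M' (dR ∷ q) ≡ M (dR ∷ q)) → Step M M'
    appʳ   : ∀ {M M' A'} → M [] ≡ app → Step (M · dR) A' →
             M' [] ≡ app → (∀ q → M' (dL ∷ q) ≡ M (dL ∷ q)) →
             (∀ q → M' (dR ∷ q) ≡ A' q) → Step M M'

  _↠_ : Tm C → Tm C → Set
  _↠_ = Star Step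

  -- strongly convergent (possibly infinite) reduction, via its standard
  -- coinductive characterisation (finite reduction to a term with the
  -- root symbol of the target, then coinductively on the immediate
  -- subterms), with the coinductive derivation tree laid out over the
  -- positions p of the target: src p reduces finitely to mid p, whose
  -- root label is N's label at p, and the children of mid p are the
  -- sources for the children of p.
  record _↠∞_ (M N : Tm C) : Set where
    field
      src      : Addr → Tm C
      mid      : Addr → Tm C
      src-root : ∀ q → src [] q ≡ M q
      fin      : ∀ p → Pos N p → src p ↠ mid p
      root     : ∀ p → Pos N p → mid p [] ≡ N p
      child    : ∀ p d → Pos N (p ++ d ∷ []) →
                 ∀ q → src (p ++ d ∷ []) q ≡ mid p (d ∷ q)

  Normal : Tm C → Set
  Normal M = ∀ M' → ¬ Step M M'

noConst : ⊥ → Λ∞ → Set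
noConst ()

module Pure = Calculus noConst

RootActive : Λ∞ → Set
RootActive M = ∀ N → M Pure.↠∞ N → Σ Λ∞ λ R → (N Pure.↠∞ R) × Redex R

HA : Λ∞ → Set
HA M = Σ Λ∞ λ N → (M Pure.↠ N) × LamPrefix (AppSpine RootActive) N

IL : Λ∞ → Set
IL M = Σ Λ∞ λ N → (M Pure.↠∞ N) × LamPrefix InfLeft N

O : Λ∞ → Set
O M = Σ Λ∞ λ N → (M Pure.↠∞ N) × AllLam N

IL∪O : Λ∞ → Set
IL∪O M = IL M ⊎ O M

-- Closed finite or infinite propositions over truth values V
-- (again as labelling functions on addresses; p₁/p₂ = first/second
-- operand, ¬ uses p₁)

data PDir : Set where
  p₁ p₂ : PDir

data PLbl (V : Set) : Set where
  val : V → PLbl V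
  and or imp not : PLbl V

Prop : Set → Set
Prop V = List PDir → PLbl V

_∙_ : ∀ {V} → Prop V → PDir → Prop V
(φ ∙ d) q = φ (d ∷ q)

data TV (C : Set) : Set where
  vT vF : TV C
  v⊥    : C → TV C

Tt : ∀ {C} → Tm C
Tt []          = lam
Tt (_ ∷ [])    = lam
Tt (_ ∷ _ ∷ _) = var 1

Ff : ∀ {C} → Tm C
Ff []          = lam
Ff (_ ∷ [])    = lam
Ff (_ ∷ _ ∷ _) = var 0

tvTm : ∀ {C} → TV C → Tm C
tvTm vT     = Tt
tvTm vF     = Ff
tvTm (v⊥ c) = λ _ → con c

-- Encoding  ¬M ≡ M F T,  M∧N ≡ M N M,  M∨N ≡ M M N,  M→N ≡ M N T
data EncSt (C : Set) : Set where
  prop  : Prop (TV C) → EncSt C                 -- ⟦ φ ⟧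
  ap2   : Prop (TV C) → Prop (TV C) → EncSt C   -- ⟦ φ ⟧ ⟦ ψ ⟧
  ap1   : Prop (TV C) → Tm C → EncSt C          -- ⟦ φ ⟧ t
  fixed : Tm C → EncSt C                        -- a given term

rootE : ∀ {C} → EncSt C → Lbl C
rootE (prop φ) with φ []
... | val v = tvTm v []
... | _     = app
rootE (ap2 _ _)  = app
rootE (ap1 _ _)  = app
rootE (fixed t)  = t []

childE : ∀ {C} → EncSt C → Dir → EncSt C
childE (prop φ) d with φ []
childE (prop φ) d  | val v = fixed (tvTm v · d)
childE (prop φ) dL | and   = ap2 (φ ∙ p₁) (φ ∙ p₂)
childE (prop φ) _  | and   = prop (φ ∙ p₁)
childE (prop φ) dL | or    = ap2 (φ ∙ p₁) (φ ∙ p₁)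
childE (prop φ) _  | or    = prop (φ ∙ p₂)
childE (prop φ) dL | imp   = ap2 (φ ∙ p₁) (φ ∙ p₂)
childE (prop φ) _  | imp   = fixed Tt
childE (prop φ) dL | not   = ap1 (φ ∙ p₁) Ff
childE (prop φ) _  | not   = fixed Tt
childE (ap2 φ ψ) dL = prop φ
childE (ap2 φ ψ) _  = prop ψ
childE (ap1 φ t) dL = prop φ
childE (ap1 φ t) _  = fixed t
childE (fixed t) d  = fixed (t · d)

encAt : ∀ {C} → EncSt C → Tm C
encAt s []      = rootE s
encAt s (d ∷ q) = encAt (childE s d) q

⟦_⟧ : ∀ {C} → Prop (TV C) → Tm C
⟦ φ ⟧ = encAt (prop φ)

data C₁ : Set where
  ⊥HA ⊥IL ⊥O : C₁

X₁ : C₁ → Λ∞ → Set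
X₁ ⊥HA = HA
X₁ ⊥IL = IL
X₁ ⊥O  = O

data C₂ : Set where
  ⊥HA ⊥IL∪O : C₂

X₂ : C₂ → Λ∞ → Set
X₂ ⊥HA   = HA
X₂ ⊥IL∪O = IL∪O

module λ₁ = Calculus X₁
module λ₂ = Calculus X₂

{-# OPTIONS --safe #-}
-- Write ⊥ for any constant. Encodings of propositions are accepted by the top-down tree
-- automaton with states
--   bool n ::= ⊥ | λ.body₁ | unary (bool 0) | i  (i < n)
--   body₁  ::= ⊥ | λ.body₂            body₂ ::= ⊥ | 0 | 1
--   unary  ::= (bool 0) (bool 0) | λ.(bool 1)
-- The variables it admits are bound within the accepted term, so substitution preserves
-- acceptance and a β-step need only be checked at the top two nodes of the contracted body;
-- thus acceptance is preserved by β- and ⊥-steps, hence by strongly convergent reduction.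
-- In an accepted normal form no ⊥_c is applied or abstracted and the root does not start an
-- infinite left spine: otherwise, replacing each ⊥_c by a witness term of X c
-- ((λx.Ω∞)Ω∞ = Ω∞ for HA, the all-application tree for IL, the all-λ tree for O) gives a
-- term of some X c′, and a ⊥-step applies. What remains accepted is ⊥_c, λλ.1 = T and
-- λλ.0 = F.
module Submission where

open import Defs
open import Data.Nat using (ℕ; zero; suc; _+_; _∸_; _<ᵇ_; _≤_; _<_; z≤n; s≤s)
open import Data.Nat.Properties using (≤-trans; <-≤-trans; +-monoʳ-≤; <⇒<ᵇ)
open import Data.Bool using (true; if_then_else_)
open import Data.Empty using (⊥; ⊥-elim)
open import Data.Unit using (⊤; tt)
open import Data.List using ([]; _∷_; _++_; _∷ʳ_; replicate)
open import Data.List.Properties using (++-identityʳ; ++-assoc)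
open import Data.List.Reverse using (Reverse; []; _∶_∶ʳ_; reverseView)
open import Data.Product using (Σ; _×_; _,_; proj₂)
open import Data.Sum using (_⊎_; inj₁; inj₂; map₂)
open import Function using (case_of_)
open import Relation.Binary.PropositionalEquality
  using (_≡_; _≢_; _≗_; refl; sym; trans; cong; subst)
open import Relation.Binary.Construct.Closure.ReflexiveTransitive using (ε; _◅_)
open import Relation.Nullary using (¬_)

data Child {C : Set} : Lbl C → Dir → Set where
  appL : Child app dL
  appR : Child app dR
  lamB : Child lam dB

binders : ∀ {C} {l : Lbl C} {d} → Child l d → ℕ
binders appL = 0
binders appR = 0
binders lamB = 1

child-pos : ∀ {C} {M : Tm C} {l d p} → M [] ≡ l → Child l d → Pos (M · d) p → Pos M (d ∷ p)
child-pos e appL = inL e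
child-pos e appR = inR e
child-pos e lamB = inB e

record ActsOnFreeVars {C : Set} (f : ℕ → Tm C → Tm C) : Set where
  field
    root  : ∀ {k M} → (∀ {i} → M [] ≡ var i → i < k) → f k M [] ≡ M []
    child : ∀ {k} M {l d} → M [] ≡ l → (c : Child l d) →
            f k M · d ≗ f (binders c + k) (M · d)

  root-≡ : ∀ {k} M {l} → M [] ≡ l → (∀ {i} → l ≢ var i) → f k M [] ≡ l
  root-≡ M e nv = trans (root (λ e′ → ⊥-elim (nv (trans (sym e) e′)))) e

<ᵇ-true : ∀ {i k} → i < k → (i <ᵇ k) ≡ true
<ᵇ-true {i} {k} lt with i <ᵇ k | <⇒<ᵇ lt
... | true | _ = refl

subAt-actsOnFreeVars : ∀ {C} (σ : ℕ → Tm C) → ActsOnFreeVars (λ k → subAt k σ)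
subAt-actsOnFreeVars {C} σ = record { root = λ {k M} → root {k} {M} ; child = λ {k} → child {k} }
  where
  root : ∀ {k} {M : Tm C} → (∀ {i} → M [] ≡ var i → i < k) → subAt k σ M [] ≡ M []
  root {k} {M} bound with M []
  ... | var i rewrite <ᵇ-true (bound refl) = refl
  ... | con c = refl
  ... | lam = refl
  ... | app = refl

  child : ∀ {k} (M : Tm C) {l d} → M [] ≡ l → (c : Child l d) →
          subAt k σ M · d ≗ subAt (binders c + k) σ (M · d)
  child M e appL q rewrite e = refl
  child M e appR q rewrite e = refl
  child M e lamB q rewrite e = refl

renAt-actsOnFreeVars : ∀ {C} (ρ : ℕ → ℕ) → ActsOnFreeVars {C} (λ m → renAt m ρ)
renAt-actsOnFreeVars {C} ρ = record { root = λ {k M} → root {k} {M} ; child = λ {k} → child {k} }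
  where
  root : ∀ {m} {M : Tm C} → (∀ {i} → M [] ≡ var i → i < m) → renAt m ρ M [] ≡ M []
  root {m} {M} bound with M []
  ... | var i rewrite <ᵇ-true (bound refl) = refl
  ... | con c = refl
  ... | lam = refl
  ... | app = refl

  child : ∀ {m} (M : Tm C) {l d} → M [] ≡ l → (c : Child l d) →
          renAt m ρ M · d ≗ renAt (binders c + m) ρ (M · d)
  child M e appL q rewrite e = refl
  child M e appR q rewrite e = refl
  child M e lamB q rewrite e = refl

subAt-var : ∀ {C k σ} (M : Tm C) {i} p → M [] ≡ var i →
            subAt k σ M p ≡ (if i <ᵇ k then var i else shift k (σ (i ∸ k)) p)
subAt-var M p e rewrite e = refl

module Automaton {C S : Set} (Ok : S → Lbl C → Set) (Tr : S → Lbl C → Dir → S → Set)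
  (Tr-child : ∀ {s l d t} → Tr s l d t → Child l d) where

  data Run : S → Tm C → Addr → S → Set where
    here : ∀ {s M} → Run s M [] s
    step : ∀ {s M d p t u} → Tr s (M []) d t → Run t (M · d) p u → Run s M (d ∷ p) u

  Accepts : S → Tm C → Set
  Accepts s M = ∀ {p t} → Run s M p t → Ok t (M p)

  tr-≡ : ∀ {s l l′ d t} → l ≡ l′ → Tr s l d t → Tr s l′ d t
  tr-≡ {s} {d = d} {t} = subst (λ l → Tr s l d t)

  accepts-root : ∀ {s M} → Accepts s M → Ok s (M [])
  accepts-root acc = acc here

  accepts-label : ∀ {s M l} → Accepts s M → M [] ≡ l → Ok s l
  accepts-label {s} acc e = subst (Ok s) e (accepts-root acc)

  accepts-child : ∀ {s M d t} → Accepts s M → Tr s (M []) d t → Accepts t (M · d)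
  accepts-child acc tr r = acc (step tr r)

  accepts-at : ∀ {s M l d t} → Accepts s M → M [] ≡ l → Tr s l d t → Accepts t (M · d)
  accepts-at acc e tr = accepts-child acc (tr-≡ (sym e) tr)

  accepts-node : ∀ {s M l} → M [] ≡ l → Ok s l →
                 (∀ {d t} → Tr s l d t → Accepts t (M · d)) → Accepts s M
  accepts-node {s} e ok h here = subst (Ok s) (sym e) ok
  accepts-node e ok h (step tr r) = h (tr-≡ e tr) r

  accepts-leaf : ∀ {s M l} → M [] ≡ l → Ok s l → (∀ {d} → ¬ Child l d) → Accepts s M
  accepts-leaf e ok leaf = accepts-node e ok (λ tr → ⊥-elim (leaf (Tr-child tr)))

  run-≗ : ∀ {s M N p t} → M ≗ N → Run s M p t → Run s N p t
  run-≗ e here = here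
  run-≗ e (step tr r) = step (tr-≡ (e []) tr) (run-≗ (λ q → e (_ ∷ q)) r)

  accepts-≗ : ∀ {s M N} → M ≗ N → Accepts s M → Accepts s N
  accepts-≗ e acc r = subst (Ok _) (e _) (acc (run-≗ (λ q → sym (e q)) r))

  run-pos : ∀ {s M p t} → Run s M p t → Pos M p
  run-pos here = here
  run-pos (step tr r) = child-pos refl (Tr-child tr) (run-pos r)

  run-∷ʳ : ∀ {s M} p {d u} → Run s M (p ∷ʳ d) u → Σ S λ t → Run s M p t × Tr t (M p) d u
  run-∷ʳ [] (step tr here) = _ , here , tr
  run-∷ʳ (x ∷ p) (step tr r) with run-∷ʳ p r
  ... | t , r′ , tr′ = t , step tr r′ , tr′

  module Substitution (bound : S → ℕ)
    (Ok-var : ∀ {s i} → Ok s (var i) → i < bound s)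
    (Tr-bound : ∀ {s l d t} (tr : Tr s l d t) → bound t ≤ binders (Tr-child tr) + bound s)
    where

    accepts-map : ∀ {f} → ActsOnFreeVars f → ∀ {s k M} → bound s ≤ k → Accepts s M →
                  Accepts s (f k M)
    accepts-map {f} hom le acc {p} = go p le acc
      where
      open ActsOnFreeVars hom

      fixes-root : ∀ {s k M} → bound s ≤ k → Accepts s M → f k M [] ≡ M []
      fixes-root le acc = root (λ e → <-≤-trans (Ok-var (accepts-label acc e)) le)

      go : ∀ {s k M} p {u} → bound s ≤ k → Accepts s M → Run s (f k M) p u → Ok u (f k M p)
      go [] le acc here = subst (Ok _) (sym (fixes-root le acc)) (accepts-root acc)
      go {M = M} (d ∷ p) {u} le acc (step tr r) =
        subst (Ok u) (sym (child M refl c p))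
          (go p (≤-trans (Tr-bound tr′) (+-monoʳ-≤ (binders c) le))
              (accepts-child acc tr′) (run-≗ (child M refl c) r))
        where
        tr′ = tr-≡ (fixes-root le acc) tr
        c = Tr-child tr′

    accepts-subAt : ∀ σ {s k M} → bound s ≤ k → Accepts s M → Accepts s (subAt k σ M)
    accepts-subAt σ = accepts-map (subAt-actsOnFreeVars σ)

    accepts-renAt : ∀ ρ {s m M} → bound s ≤ m → Accepts s M → Accepts s (renAt m ρ M)
    accepts-renAt ρ = accepts-map (renAt-actsOnFreeVars ρ)

  module Reduction (X : C → Λ∞ → Set) (Ok-con : ∀ {s c} → Ok s (con c))
    (β-pres : ∀ {s M M′} → Accepts s M → Redex M → M′ ≗ ((M · dL) · dB) [ M · dR ] →
              Accepts s M′)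
    where
    open Calculus X

    accepts-cong : ∀ {s M M′ l} → M [] ≡ l → M′ [] ≡ l →
                   (∀ {d t} → Child l d → Accepts t (M · d) → Accepts t (M′ · d)) →
                   Accepts s M → Accepts s M′
    accepts-cong e e′ h acc =
      accepts-node e′ (accepts-label acc e) (λ tr → h (Tr-child tr) (accepts-at acc e tr))

    accepts-step : ∀ {s M M′} → Accepts s M → Step M M′ → Accepts s M′
    accepts-step acc (β e₁ e₂ eq) = β-pres acc (e₁ , e₂) eq
    accepts-step acc (⊥-rule c _ _ _ _ e) = accepts-leaf e Ok-con (λ ())
    accepts-step acc (lam e st e′ eB) = accepts-cong e e′
      (λ { lamB acc′ → accepts-≗ (λ q → sym (eB q)) (accepts-step acc′ st) }) acc
    accepts-step acc (appˡ e st e′ eL eR) = accepts-cong e e′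
      (λ { appL acc′ → accepts-≗ (λ q → sym (eL q)) (accepts-step acc′ st)
         ; appR acc′ → accepts-≗ (λ q → sym (eR q)) acc′ }) acc
    accepts-step acc (appʳ e st e′ eL eR) = accepts-cong e e′
      (λ { appL acc′ → accepts-≗ (λ q → sym (eL q)) acc′
         ; appR acc′ → accepts-≗ (λ q → sym (eR q)) (accepts-step acc′ st) }) acc

    accepts-↠ : ∀ {s M M′} → Accepts s M → M ↠ M′ → Accepts s M′
    accepts-↠ acc ε = acc
    accepts-↠ acc (st ◅ r) = accepts-↠ (accepts-step acc st) r

    accepts-↠∞ : ∀ {s M N} → Accepts s M → M ↠∞ N → Accepts s N
    accepts-↠∞ {s} {N = N} acc R {p} r = subst (Ok _) (root p (run-pos r))
      (accepts-root (accepts-↠ (accepts-src (reverseView p) r) (fin p (run-pos r))))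
      where
      open _↠∞_ R
      accepts-src : ∀ {p t} → Reverse p → Run s N p t → Accepts t (src p)
      accepts-src [] here = accepts-≗ (λ q → sym (src-root q)) acc
      accepts-src (p ∶ rp ∶ʳ d) r with run-∷ʳ p r
      ... | t , r′ , tr =
        accepts-≗ (λ q → sym (child p d (run-pos r) q))
          (accepts-at (accepts-↠ (accepts-src rp r′) (fin p (run-pos r′)))
             (root p (run-pos r′)) tr)

module StrongConvergence {C : Set} (X : C → Λ∞ → Set) where
  open Calculus X

  ↠⇒↠∞ : ∀ {M N} → M ↠ N → M ↠∞ N
  ↠⇒↠∞ {M} {N} r = record
    { src = src ; mid = N at_ ; src-root = λ q → refl
    ; fin = fin ; root = λ p _ → cong N (++-identityʳ p) ; child = child }
    where
    src : Addr → Tm C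
    src [] = M
    src (d ∷ p) = N at (d ∷ p)

    fin : ∀ p → Pos N p → src p ↠ (N at p)
    fin [] _ = r
    fin (d ∷ p) _ = ε

    child : ∀ p d → Pos N (p ++ d ∷ []) → ∀ q → src (p ++ d ∷ []) q ≡ (N at p) (d ∷ q)
    child [] d _ q = refl
    child (x ∷ p) d _ q = cong (λ a → N (x ∷ a)) (++-assoc p (d ∷ []) q)

  ↠∞-refl : ∀ {M} → M ↠∞ M
  ↠∞-refl = ↠⇒↠∞ ε

module Boolean {C : Set} where

  data BState : Set where
    bool : ℕ → BState
    unary body₁ body₂ : BState

  BoolOk : BState → Lbl C → Set
  BoolOk (bool n) (var i) = i < n
  BoolOk (bool n) _ = ⊤
  BoolOk unary (var _) = ⊥
  BoolOk unary _ = ⊤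
  BoolOk body₁ (con _) = ⊤
  BoolOk body₁ lam = ⊤
  BoolOk body₁ _ = ⊥
  BoolOk body₂ (con _) = ⊤
  BoolOk body₂ (var i) = i < 2
  BoolOk body₂ _ = ⊥

  data BoolTr : BState → Lbl C → Dir → BState → Set where
    bool-fun  : ∀ {n} → BoolTr (bool n) app dL unary
    bool-arg  : ∀ {n} → BoolTr (bool n) app dR (bool 0)
    bool-lam  : ∀ {n} → BoolTr (bool n) lam dB body₁
    body₁-lam : BoolTr body₁ lam dB body₂
    unary-fun : BoolTr unary app dL (bool 0)
    unary-arg : BoolTr unary app dR (bool 0)
    unary-lam : BoolTr unary lam dB (bool 1)

  BoolTr-child : ∀ {s l d t} → BoolTr s l d t → Child l d
  BoolTr-child bool-fun  = appL
  BoolTr-child bool-arg  = appR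
  BoolTr-child bool-lam  = lamB
  BoolTr-child body₁-lam = lamB
  BoolTr-child unary-fun = appL
  BoolTr-child unary-arg = appR
  BoolTr-child unary-lam = lamB

  open Automaton BoolOk BoolTr BoolTr-child public

  bound : BState → ℕ
  bound (bool n) = n
  bound unary = 0
  bound body₁ = 1
  bound body₂ = 2

  BoolOk-var : ∀ {s i} → BoolOk s (var i) → i < bound s
  BoolOk-var {bool n} lt = lt
  BoolOk-var {body₂} lt = lt

  BoolTr-bound : ∀ {s l d t} (tr : BoolTr s l d t) → bound t ≤ binders (BoolTr-child tr) + bound s
  BoolTr-bound bool-fun  = z≤n
  BoolTr-bound bool-arg  = z≤n
  BoolTr-bound bool-lam  = s≤s z≤n
  BoolTr-bound body₁-lam = s≤s (s≤s z≤n)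
  BoolTr-bound unary-fun = z≤n
  BoolTr-bound unary-arg = z≤n
  BoolTr-bound unary-lam = s≤s z≤n

  open Substitution bound BoolOk-var BoolTr-bound public

  BoolOk-con : ∀ {s c} → BoolOk s (con c)
  BoolOk-con {bool _} = tt
  BoolOk-con {unary} = tt
  BoolOk-con {body₁} = tt
  BoolOk-con {body₂} = tt

  bool-reindex : ∀ {m n M} → BoolOk (bool n) (M []) → Accepts (bool m) M → Accepts (bool n) M
  bool-reindex ok acc = accepts-node refl ok (λ tr → accepts-child acc (reindex tr))
    where
    reindex : ∀ {m n l d t} → BoolTr (bool n) l d t → BoolTr (bool m) l d t
    reindex bool-fun = bool-fun
    reindex bool-arg = bool-arg
    reindex bool-lam = bool-lam

  bool-weaken : ∀ {m n M} → m ≤ n → Accepts (bool m) M → Accepts (bool n) M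
  bool-weaken {M = M} le acc = bool-reindex (weaken (M []) (accepts-root acc)) acc
    where
    weaken : ∀ l → BoolOk (bool _) l → BoolOk (bool _) l
    weaken (var i) lt = <-≤-trans lt le
    weaken (con c) _ = tt
    weaken lam _ = tt
    weaken app _ = tt

  β-bool : ∀ {W A : Tm C} → Accepts (bool 1) W → Accepts (bool 0) A → Accepts (bool 0) (W [ A ])
  β-bool {W} {A} accW accA = by-root (W []) refl
    where
    open ActsOnFreeVars (subAt-actsOnFreeVars (β-env A))
    by-root : ∀ l → W [] ≡ l → Accepts (bool 0) (W [ A ])
    by-root (var zero) e =
      accepts-≗ (λ q → sym (subAt-var W q e)) (accepts-renAt (0 +_) z≤n accA)
    by-root (var (suc i)) e = ⊥-elim (case accepts-label accW e of λ { (s≤s ()) })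
    by-root (con c) e = accepts-leaf (root-≡ W e (λ ())) tt (λ ())
    by-root lam e = accepts-subAt _ z≤n (bool-reindex (subst (BoolOk (bool 0)) (sym e) tt) accW)
    by-root app e = accepts-subAt _ z≤n (bool-reindex (subst (BoolOk (bool 0)) (sym e) tt) accW)

  β-body₂ : ∀ {V A : Tm C} → Accepts body₂ V → Accepts (bool 0) A →
            Accepts (bool 1) (subAt 1 (β-env A) V)
  β-body₂ {V} {A} accV accA = by-root (V []) refl
    where
    open ActsOnFreeVars (subAt-actsOnFreeVars (β-env A))
    by-root : ∀ l → V [] ≡ l → Accepts (bool 1) (subAt 1 (β-env A) V)
    by-root (var zero) e = accepts-leaf (subAt-var V [] e) (s≤s z≤n) (λ ())
    by-root (var (suc zero)) e = bool-weaken z≤n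
      (accepts-≗ (λ q → sym (subAt-var V q e)) (accepts-renAt (1 +_) z≤n accA))
    by-root (var (suc (suc i))) e =
      ⊥-elim (case accepts-label accV e of λ { (s≤s (s≤s ())) })
    by-root (con c) e = accepts-leaf (root-≡ V e (λ ())) tt (λ ())
    by-root lam e = ⊥-elim (accepts-label accV e)
    by-root app e = ⊥-elim (accepts-label accV e)

  β-unary : ∀ {Y A : Tm C} → Accepts body₁ Y → Accepts (bool 0) A → Accepts unary (Y [ A ])
  β-unary {Y} {A} accY accA = by-root (Y []) refl
    where
    open ActsOnFreeVars (subAt-actsOnFreeVars (β-env A))
    by-root : ∀ l → Y [] ≡ l → Accepts unary (Y [ A ])
    by-root (con c) e = accepts-leaf (root-≡ Y e (λ ())) tt (λ ())
    by-root lam e = accepts-node (root-≡ Y e (λ ())) tt λ { unary-lam →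
      accepts-≗ (λ q → sym (child Y e lamB q)) (β-body₂ (accepts-at accY e body₁-lam) accA) }
    by-root (var i) e = ⊥-elim (accepts-label accY e)
    by-root app e = ⊥-elim (accepts-label accY e)

  β-pres : ∀ {s M M′} → Accepts s M → Redex M → M′ ≗ ((M · dL) · dB) [ M · dR ] → Accepts s M′
  β-pres {bool n} acc (e₁ , e₂) eq = accepts-≗ (λ q → sym (eq q)) (bool-weaken z≤n
    (β-bool (accepts-at (accepts-at acc e₁ bool-fun) e₂ unary-lam) (accepts-at acc e₁ bool-arg)))
  β-pres {unary} acc (e₁ , e₂) eq = accepts-≗ (λ q → sym (eq q))
    (β-unary (accepts-at (accepts-at acc e₁ unary-fun) e₂ bool-lam) (accepts-at acc e₁ unary-arg))
  β-pres {body₁} acc (e₁ , _) _ = ⊥-elim (accepts-label acc e₁)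
  β-pres {body₂} acc (e₁ , _) _ = ⊥-elim (accepts-label acc e₁)

  accepts-Tt : Accepts (bool 0) (Tt {C})
  accepts-Tt here = tt
  accepts-Tt (step bool-lam here) = tt
  accepts-Tt (step bool-lam (step body₁-lam here)) = s≤s (s≤s z≤n)
  accepts-Tt (step bool-lam (step body₁-lam (step () _)))

  accepts-Ff : Accepts (bool 0) (Ff {C})
  accepts-Ff here = tt
  accepts-Ff (step bool-lam here) = tt
  accepts-Ff (step bool-lam (step body₁-lam here)) = s≤s z≤n
  accepts-Ff (step bool-lam (step body₁-lam (step () _)))

  accepts-tvTm : ∀ v → Accepts (bool 0) (tvTm {C} v)
  accepts-tvTm vT = accepts-Tt
  accepts-tvTm vF = accepts-Ff
  accepts-tvTm (v⊥ c) = accepts-leaf refl tt (λ ())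

  data Encodes : BState → EncSt C → Set where
    prop  : ∀ {φ} → Encodes (bool 0) (prop φ)
    ap2   : ∀ {φ ψ} → Encodes unary (ap2 φ ψ)
    ap1   : ∀ {φ t} → Accepts (bool 0) t → Encodes unary (ap1 φ t)
    fixed : ∀ {s t} → Accepts s t → Encodes s (fixed t)

  encodes-root : ∀ {s st} → Encodes s st → BoolOk s (rootE st)
  encodes-root (prop {φ}) with φ []
  ... | val v = accepts-root (accepts-tvTm v)
  ... | and = tt
  ... | or  = tt
  ... | imp = tt
  ... | not = tt
  encodes-root ap2 = tt
  encodes-root (ap1 _) = tt
  encodes-root (fixed acc) = accepts-root acc

  encodes-child : ∀ {s st d t} → Encodes s st → BoolTr s (rootE st) d t → Encodes t (childE st d)
  encodes-child (prop {φ}) tr with φ []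
  encodes-child prop tr       | val v = fixed (accepts-child (accepts-tvTm v) tr)
  encodes-child prop bool-fun | and = ap2
  encodes-child prop bool-arg | and = prop
  encodes-child prop bool-fun | or  = ap2
  encodes-child prop bool-arg | or  = prop
  encodes-child prop bool-fun | imp = ap2
  encodes-child prop bool-arg | imp = fixed accepts-Tt
  encodes-child prop bool-fun | not = ap1 accepts-Ff
  encodes-child prop bool-arg | not = fixed accepts-Tt
  encodes-child ap2 unary-fun = prop
  encodes-child ap2 unary-arg = prop
  encodes-child (ap1 _) unary-fun = prop
  encodes-child (ap1 acc) unary-arg = fixed acc
  encodes-child (fixed acc) tr = fixed (accepts-child acc tr)

  accepts-encAt : ∀ {s st} → Encodes s st → Accepts s (encAt st)
  accepts-encAt en here = encodes-root en
  accepts-encAt en (step tr r) = accepts-encAt (encodes-child en tr) r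

  accepts-⟦⟧ : ∀ φ → Accepts (bool 0) ⟦ φ ⟧
  accepts-⟦⟧ φ = accepts-encAt prop

module Redexes where

  data RState : Set where
    redex abs : RState

  ROk : RState → Lbl ⊥ → Set
  ROk redex l = l ≡ app
  ROk abs l = l ≡ lam

  data RTr : RState → Lbl ⊥ → Dir → RState → Set where
    redex-fun : RTr redex app dL abs
    redex-arg : RTr redex app dR redex
    abs-body  : RTr abs lam dB redex

  RTr-child : ∀ {s l d t} → RTr s l d t → Child l d
  RTr-child redex-fun = appL
  RTr-child redex-arg = appR
  RTr-child abs-body  = lamB

  open Automaton ROk RTr RTr-child

  ROk-var : ∀ {s i} → ROk s (var i) → i < 0
  ROk-var {redex} ()
  ROk-var {abs} ()

  open Substitution (λ _ → 0) ROk-var (λ _ → z≤n)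

  β-pres : ∀ {s M M′} → Accepts s M → Redex M → M′ ≗ ((M · dL) · dB) [ M · dR ] → Accepts s M′
  β-pres {redex} acc (e₁ , e₂) eq = accepts-≗ (λ q → sym (eq q))
    (accepts-subAt _ z≤n (accepts-at (accepts-at acc e₁ redex-fun) e₂ abs-body))
  β-pres {abs} acc (e₁ , _) _ = case accepts-label acc e₁ of λ ()

  ROk-con : ∀ {s} {c : ⊥} → ROk s (con c)
  ROk-con {c = ()}

  open Reduction noConst ROk-con β-pres
  open StrongConvergence noConst

  rootActive : ∀ {M} → Accepts redex M → RootActive M
  rootActive acc N R = N , ↠∞-refl , accN here , accepts-at accN (accN here) redex-fun here
    where accN = accepts-↠∞ acc R

  Ω∞ : Λ∞
  Ω∞ [] = app
  Ω∞ (dL ∷ []) = lam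
  Ω∞ (dL ∷ dB ∷ q) = Ω∞ q
  Ω∞ (dR ∷ q) = Ω∞ q
  Ω∞ _ = app

  accepts-Ω∞ : Accepts redex Ω∞
  accepts-Ω∞ here = refl
  accepts-Ω∞ (step redex-fun here) = refl
  accepts-Ω∞ (step redex-fun (step abs-body r)) = accepts-Ω∞ r
  accepts-Ω∞ (step redex-arg r) = accepts-Ω∞ r

  Ω∞-rootActive : ∀ {M} → M ≗ Ω∞ → RootActive M
  Ω∞-rootActive e = rootActive (accepts-≗ (λ q → sym (e q)) accepts-Ω∞)

record Witness (P : Λ∞ → Set) : Set where
  field
    term  : Λ∞
    term∈ : ∀ {M} → M ≗ term → P M
    app∈  : ∀ {M} → M [] ≡ app → M · dL ≗ term → P M
    lam∈  : ∀ {M} → M [] ≡ lam → M · dB ≗ term → P M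

Witness-map : ∀ {P Q : Λ∞ → Set} → (∀ {M} → P M → Q M) → Witness P → Witness Q
Witness-map f w = record
  { term = term ; term∈ = λ e → f (term∈ e)
  ; app∈ = λ e eL → f (app∈ e eL) ; lam∈ = λ e eB → f (lam∈ e eB) }
  where open Witness w

open StrongConvergence noConst

HA-witness : Witness HA
HA-witness = record
  { term = Ω∞
  ; term∈ = λ e → head-normal (body (head (Ω∞-rootActive e)))
  ; app∈ = λ e eL → head-normal (body (app e (head (Ω∞-rootActive eL))))
  ; lam∈ = λ e eB → head-normal (lam e (body (head (Ω∞-rootActive eB))))
  }
  where
  open Redexes using (Ω∞; Ω∞-rootActive)
  head-normal : ∀ {M} → LamPrefix (AppSpine RootActive) M → HA M
  head-normal s = _ , ε , s

InfLeft⇒IL : ∀ {M} → InfLeft M → IL M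
InfLeft⇒IL inf = _ , ↠∞-refl , body inf

IL-witness : Witness IL
IL-witness = record
  { term = λ _ → app
  ; term∈ = λ e → InfLeft⇒IL (λ n → e _)
  ; app∈ = λ e eL → InfLeft⇒IL (λ { zero → e ; (suc n) → eL _ })
  ; lam∈ = λ e eB → _ , ↠∞-refl , lam e (body (λ n → eB _))
  }

module _ {C : Set} (σ : ℕ → Tm C) where
  open ActsOnFreeVars (subAt-actsOnFreeVars σ)

  subAt-AllLam : ∀ {k} (t : Tm C) → AllLam t → AllLam (subAt k σ t)
  subAt-AllLam t all zero = root-≡ t (all 0) (λ ())
  subAt-AllLam t all (suc n) =
    trans (child t (all 0) lamB (replicate n dB)) (subAt-AllLam (t · dB) (λ m → all (suc m)) n)

O-witness : Witness O
O-witness = record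
  { term = λ _ → lam
  ; term∈ = λ e → _ , ↠∞-refl , (λ n → e _)
  ; app∈ = λ {M} e eL → _ , ↠⇒↠∞ (β e (eL []) (λ q → refl) ◅ ε) ,
                        subAt-AllLam _ ((M · dL) · dB) (λ n → eL (dB ∷ replicate n dB))
  ; lam∈ = λ e eB → _ , ↠∞-refl , (λ { zero → e ; (suc n) → eB _ })
  }
  where open Pure

replaceChild : ∀ {C} → Tm C → Dir → Tm C → Tm C
replaceChild M d T [] = M []
replaceChild M dL T (dL ∷ q) = T q
replaceChild M dR T (dR ∷ q) = T q
replaceChild M dB T (dB ∷ q) = T q
replaceChild M _ T (d′ ∷ q) = M (d′ ∷ q)

module NormalForms {C : Set} {X : C → Λ∞ → Set} (witness : ∀ c → Witness (X c))
  (InfLeft⇒X : ∀ {M} → InfLeft M → Σ C λ c → X c M) where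
  open Calculus X
  open Boolean {C}
  open Reduction X BoolOk-con β-pres

  instantiate : Tm C → Λ∞
  instantiateAt : Lbl C → Tm C → Addr → Lbl ⊥
  instantiate N p = instantiateAt (N []) N p
  instantiateAt (con c) N p = Witness.term (witness c) p
  instantiateAt (var i) N [] = var i
  instantiateAt lam N [] = lam
  instantiateAt app N [] = app
  instantiateAt _ N (d ∷ q) = instantiate (N · d) q

  instantiate-≡ : ∀ N {l} → N [] ≡ l → instantiate N ≗ instantiateAt l N
  instantiate-≡ N e q = cong (λ l → instantiateAt l N q) e

  instantiate-child : ∀ N {l d} → N [] ≡ l → Child l d → instantiate N · d ≗ instantiate (N · d)
  instantiate-child N e appL q = instantiate-≡ N e (dL ∷ q)
  instantiate-child N e appR q = instantiate-≡ N e (dR ∷ q)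
  instantiate-child N e lamB q = instantiate-≡ N e (dB ∷ q)

  instantiate-Repl : ∀ N → Repl N (instantiate N)
  instantiate-Repl N p P = go P (λ q → refl)
    where
    root-label : ∀ N {M₀} l → N [] ≡ l → M₀ ≗ instantiate N → ReplLbl l M₀
    root-label N (var i) e eq = trans (eq []) (instantiate-≡ N e [])
    root-label N (con c) e eq = Witness.term∈ (witness c) (λ q → trans (eq q) (instantiate-≡ N e q))
    root-label N lam e eq = trans (eq []) (instantiate-≡ N e [])
    root-label N app e eq = trans (eq []) (instantiate-≡ N e [])

    go : ∀ {N p M₀} → Pos N p → M₀ ≗ instantiate N at p → ReplLbl (N p) M₀
    go {N} here eq = root-label N (N []) refl eq
    go {N} {_ ∷ p} (inL e P) eq = go P (λ q → trans (eq q) (instantiate-child N e appL (p ++ q)))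
    go {N} {_ ∷ p} (inR e P) eq = go P (λ q → trans (eq q) (instantiate-child N e appR (p ++ q)))
    go {N} {_ ∷ p} (inB e P) eq = go P (λ q → trans (eq q) (instantiate-child N e lamB (p ++ q)))

  instantiate-InfLeft : ∀ N → InfLeft N → InfLeft (instantiate N)
  instantiate-InfLeft N inf zero = instantiate-≡ N (inf 0) []
  instantiate-InfLeft N inf (suc n) = trans (instantiate-child N (inf 0) appL (replicate n dL))
    (instantiate-InfLeft (N · dL) (λ m → inf (suc m)) n)

  normal-∉X : ∀ {N l c} → Normal N → N [] ≡ l → (∀ {c′} → l ≢ con c′) → ¬ X c (instantiate N)
  normal-∉X {N} {c = c} nf e ne x =
    nf (λ _ → con c) (⊥-rule _ (λ e′ → ne (trans (sym e) e′)) _ (instantiate-Repl N) x refl)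

  normal-child : ∀ {N l d} → Normal N → N [] ≡ l → Child l d → Normal (N · d)
  normal-child {N} nf e appL F st = nf (replaceChild N dL F) (appˡ e st e (λ q → refl) (λ q → refl))
  normal-child {N} nf e appR A st = nf (replaceChild N dR A) (appʳ e st e (λ q → refl) (λ q → refl))
  normal-child {N} nf e lamB B st = nf (replaceChild N dB B) (lam e st e (λ q → refl))

  normal-¬redex : ∀ {N} → Normal N → N [] ≡ app → N (dL ∷ []) ≢ lam
  normal-¬redex nf e e′ = nf _ (β e e′ (λ q → refl))

  normal-¬⊥-applied : ∀ {N c} → Normal N → N [] ≡ app → N (dL ∷ []) ≢ con c
  normal-¬⊥-applied {N} {c} nf e e′ = normal-∉X nf e (λ ())
    (Witness.app∈ (witness c) (instantiate-≡ N e [])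
      (λ q → trans (instantiate-child N e appL q) (instantiate-≡ (N · dL) e′ q)))

  normal-¬λ⊥ : ∀ {N c} → Normal N → N [] ≡ lam → N (dB ∷ []) ≢ con c
  normal-¬λ⊥ {N} {c} nf e e′ = normal-∉X nf e (λ ())
    (Witness.lam∈ (witness c) (instantiate-≡ N e [])
      (λ q → trans (instantiate-child N e lamB q) (instantiate-≡ (N · dB) e′ q)))

  normal-fun-app : ∀ {s N} → Accepts s (N · dL) → (∀ {i} → ¬ BoolOk s (var i)) →
                   Normal N → N [] ≡ app → N (dL ∷ []) ≡ app
  normal-fun-app {N = N} acc no-var nf e = by-label (N (dL ∷ [])) refl
    where
    by-label : ∀ l → N (dL ∷ []) ≡ l → N (dL ∷ []) ≡ app
    by-label app e′ = e′
    by-label lam e′ = ⊥-elim (normal-¬redex nf e e′)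
    by-label (con c) e′ = ⊥-elim (normal-¬⊥-applied nf e e′)
    by-label (var i) e′ = ⊥-elim (no-var (accepts-label acc e′))

  infLeft-bool : ∀ {N} → Accepts (bool 0) N → Normal N → N [] ≡ app → InfLeft N
  infLeft-unary : ∀ {N} → Accepts unary N → Normal N → N [] ≡ app → InfLeft N
  infLeft-bool acc nf e zero = e
  infLeft-bool acc nf e (suc n) =
    infLeft-unary acc′ (normal-child nf e appL) (normal-fun-app acc′ (λ ()) nf e) n
    where acc′ = accepts-at acc e bool-fun
  infLeft-unary acc nf e zero = e
  infLeft-unary acc nf e (suc n) =
    infLeft-bool acc′ (normal-child nf e appL) (normal-fun-app acc′ (λ ()) nf e) n
    where acc′ = accepts-at acc e unary-fun

  normal-λ : ∀ {N} → Accepts (bool 0) N → Normal N → N [] ≡ lam → IsT N ⊎ IsF N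
  normal-λ {N} acc nf e = by-body (N (dB ∷ [])) refl
    where
    accY = accepts-at acc e bool-lam

    by-body₂ : ∀ l → N (dB ∷ []) ≡ lam → N (dB ∷ dB ∷ []) ≡ l → IsT N ⊎ IsF N
    by-body₂ (var zero) e₁ e₂ = inj₂ (e , e₁ , e₂)
    by-body₂ (var (suc zero)) e₁ e₂ = inj₁ (e , e₁ , e₂)
    by-body₂ (var (suc (suc i))) e₁ e₂ =
      ⊥-elim (case accepts-label (accepts-at accY e₁ body₁-lam) e₂ of λ { (s≤s (s≤s ())) })
    by-body₂ (con c) e₁ e₂ = ⊥-elim (normal-¬λ⊥ (normal-child nf e lamB) e₁ e₂)
    by-body₂ lam e₁ e₂ = ⊥-elim (accepts-label (accepts-at accY e₁ body₁-lam) e₂)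
    by-body₂ app e₁ e₂ = ⊥-elim (accepts-label (accepts-at accY e₁ body₁-lam) e₂)

    by-body : ∀ l → N (dB ∷ []) ≡ l → IsT N ⊎ IsF N
    by-body lam e₁ = by-body₂ (N (dB ∷ dB ∷ [])) e₁ refl
    by-body (con c) e₁ = ⊥-elim (normal-¬λ⊥ nf e e₁)
    by-body (var i) e₁ = ⊥-elim (accepts-label accY e₁)
    by-body app e₁ = ⊥-elim (accepts-label accY e₁)

  normal-bool : ∀ {N} → Accepts (bool 0) N → Normal N → IsT N ⊎ IsF N ⊎ Σ C λ c → IsConst c N
  normal-bool {N} acc nf = by-root (N []) refl
    where
    by-root : ∀ l → N [] ≡ l → IsT N ⊎ IsF N ⊎ Σ C λ c → IsConst c N
    by-root (con c) e = inj₂ (inj₂ (c , e))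
    by-root (var i) e = ⊥-elim (case accepts-label acc e of λ ())
    by-root app e = ⊥-elim (normal-∉X nf e (λ ())
      (proj₂ (InfLeft⇒X (instantiate-InfLeft N (infLeft-bool acc nf e)))))
    by-root lam e = map₂ inj₁ (normal-λ acc nf e)

  normal-form : ∀ φ {N} → ⟦ φ ⟧ ↠∞ N → Normal N → IsT N ⊎ IsF N ⊎ Σ C λ c → IsConst c N
  normal-form φ R nf = normal-bool (accepts-↠∞ (accepts-⟦⟧ φ) R) nf

witness₁ : ∀ c → Witness (X₁ c)
witness₁ ⊥HA = HA-witness
witness₁ ⊥IL = IL-witness
witness₁ ⊥O  = O-witness

witness₂ : ∀ c → Witness (X₂ c)
witness₂ ⊥HA    = HA-witness
witness₂ ⊥IL∪O = Witness-map inj₁ IL-witness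

module NF₁ = NormalForms witness₁ (λ inf → ⊥IL , InfLeft⇒IL inf)
module NF₂ = NormalForms witness₂ (λ inf → ⊥IL∪O , inj₁ (InfLeft⇒IL inf))

which-⊥₁ : ∀ {N} → Σ C₁ (λ c → IsConst c N) → IsConst ⊥HA N ⊎ IsConst ⊥IL N ⊎ IsConst ⊥O N
which-⊥₁ (⊥HA , e) = inj₁ e
which-⊥₁ (⊥IL , e) = inj₂ (inj₁ e)
which-⊥₁ (⊥O  , e) = inj₂ (inj₂ e)

which-⊥₂ : ∀ {N} → Σ C₂ (λ c → IsConst c N) → IsConst ⊥HA N ⊎ IsConst ⊥IL∪O N
which-⊥₂ (⊥HA    , e) = inj₁ e
which-⊥₂ (⊥IL∪O , e) = inj₂ e

theorem12 :
    (∀ (φ : Prop (TV C₁)) (N : Tm C₁) → ⟦ φ ⟧ λ₁.↠∞ N → λ₁.Normal N →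
      IsT N ⊎ IsF N ⊎ IsConst ⊥HA N ⊎ IsConst ⊥IL N ⊎ IsConst ⊥O N)
    ×
    (∀ (φ : Prop (TV C₂)) (N : Tm C₂) → ⟦ φ ⟧ λ₂.↠∞ N → λ₂.Normal N →
      IsT N ⊎ IsF N ⊎ IsConst ⊥HA N ⊎ IsConst ⊥IL∪O N)
theorem12 =
  (λ φ N R nf → map₂ (map₂ (which-⊥₁ {N})) (NF₁.normal-form φ R nf)) ,
  (λ φ N R nf → map₂ (map₂ (which-⊥₂ {N})) (NF₂.normal-form φ R nf))
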